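{- Let $k$ be a positive integer and let $G$ be a connected $(k+1)$-critical graph. Then $rd(G)\geq k$.
   Context: All graphs are simple, finite and undirected. A graph $G$ is (color-)critical if $\chi(H)<\chi(G)$ for every proper subgraph $H$ of $G$, where $\chi$ is the chromatic number; a $(k+1)$-critical graph is a critical graph with $\chi(G)=k+1$. For an edge-coloring of $G$ (adjacent edges may receive the same color), an edge-cut $R$ is a rainbow cut if no two edges of $R$ have the same color; it is a $u$-$v$ rainbow cut if $u$ and $v$ lie in different components of $G-R$. $G$ is rainbow disconnected if every two vertices $u,v$ have a $u$-$v$ rainbow cut. For a nontrivial connected graph $G$, $rd(G)$ is the smallest number of colors in an edge-coloring making $G$ rainbow disconnected. -}

module Defs where

open import Data.Nat using (ℕ; zero; suc)
open import Data.Fin using (Fin)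
open import Data.Bool using (Bool; true; false)
open import Data.Product using (Σ; ∃; _×_; _,_)
open import Data.Sum using (_⊎_)
open import Relation.Binary.PropositionalEquality using (_≡_; _≢_)
open import Relation.Nullary using (¬_)

record Graph : Set where
  field
    n      : ℕ
    adj    : Fin n → Fin n → Bool
    sym    : ∀ u v → adj u v ≡ adj v u
    irrefl : ∀ v → adj v v ≡ false
open Graph public

data Reach {n : ℕ} (E : Fin n → Fin n → Bool) : Fin n → Fin n → Set where
  here : ∀ {u} → Reach E u u
  step : ∀ {u w v} → E u w ≡ true → Reach E w v → Reach E u v

Connected : Graph → Set
Connected G = ∀ u v → Reach (adj G) u v

record Subgraph (G : Graph) : Set where
  field
    vs      : Fin (n G) → Bool
    es      : Fin (n G) → Fin (n G) → Bool
    es-sym  : ∀ u v → es u v ≡ es v u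
    es-adj  : ∀ u v → es u v ≡ true → adj G u v ≡ true
    es-vs   : ∀ u v → es u v ≡ true → vs u ≡ true
open Subgraph public

ProperSubgraph : (G : Graph) → Subgraph G → Set
ProperSubgraph G H =
  (∃ λ v → vs H v ≡ false) ⊎
  (∃ λ u → ∃ λ v → adj G u v ≡ true × es H u v ≡ false)

Colorable : Graph → ℕ → Set
Colorable G c = Σ (Fin (n G) → Fin c) λ f →
  ∀ u v → adj G u v ≡ true → f u ≢ f v

-- H (a subgraph of G) has a proper vertex colouring with c colours
-- (colours on deleted vertices are irrelevant).
SubColorable : (G : Graph) → Subgraph G → ℕ → Set
SubColorable G H c = Σ (Fin (n G) → Fin c) λ f →
  ∀ u v → es H u v ≡ true → f u ≢ f v

ChromaticNumber : Graph → ℕ → Set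
ChromaticNumber G c = Colorable G c × (∀ d → Colorable G d → c Data.Nat.≤ d)

Critical : Graph → ℕ → Set
Critical G k = ChromaticNumber G (suc k) ×
  (∀ (H : Subgraph G) → ProperSubgraph G H → SubColorable G H k)

record EdgeColoring (G : Graph) (m : ℕ) : Set where
  field
    col     : Fin (n G) → Fin (n G) → Fin m
    col-sym : ∀ u v → col u v ≡ col v u
open EdgeColoring public

record EdgeSet (G : Graph) : Set where
  field
    mem     : Fin (n G) → Fin (n G) → Bool
    mem-sym : ∀ u v → mem u v ≡ mem v u
    mem-adj : ∀ u v → mem u v ≡ true → adj G u v ≡ true
open EdgeSet public

remove : (G : Graph) → EdgeSet G → Fin (n G) → Fin (n G) → Bool
remove G R u v with mem R u v
... | true  = false
... | false = adj G u v

Rainbow : {G : Graph} {m : ℕ} → EdgeColoring G m → EdgeSet G → Set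
Rainbow {G} c R = ∀ a b x y → mem R a b ≡ true → mem R x y ≡ true →
  col c a b ≡ col c x y → (a ≡ x × b ≡ y) ⊎ (a ≡ y × b ≡ x)

RainbowCut : {G : Graph} {m : ℕ} → EdgeColoring G m → Fin (n G) → Fin (n G) → EdgeSet G → Set
RainbowCut {G} c u v R = Rainbow c R × ¬ Reach (remove G R) u v

RainbowDisconnected : {G : Graph} {m : ℕ} → EdgeColoring G m → Set
RainbowDisconnected {G} c = ∀ u v → u ≢ v → Σ (EdgeSet G) λ R → RainbowCut c u v R

RdAtLeast : Graph → ℕ → Set
RdAtLeast G k = ∀ m (c : EdgeColoring G m) → RainbowDisconnected c → k Data.Nat.≤ m

-- If m < k colours made G rainbow disconnected, take an edge uv and a rainbow u-v cut R.
-- The side S of u in G - R and its complement induce proper subgraphs, so both are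
-- k-colourable, say by f₁ and f₂. Gluing f₁ on S with f₂ shifted by s (mod k) cannot be
-- a proper colouring of G, so for each of the k shifts s some edge xy of R, x ∈ S, y ∉ S,
-- has f₁ x = f₂ y + s. The shift is determined by the edge, and distinct edges of R carry
-- distinct colours, so R, hence the colouring, has at least k colours.
module Submission where

open import Defs hiding (sym)
open import Data.Nat using (ℕ; suc; _≤_; _+_; _∸_; _%_; _≤?_)
open import Data.Nat.Properties using (+-comm; +-assoc; m+[n∸m]≡n; 1+n≰n; <⇒≤)
open import Data.Nat.DivMod using (m%n<n; %-distribˡ-+; m%n%n≡m%n; [m+n]%n≡m%n; m<n⇒m%n≡m)
open import Data.Fin using (Fin; zero; suc; toℕ; fromℕ<)
open import Data.Fin.Properties using (toℕ-fromℕ<; toℕ-injective; toℕ<n; injective⇒≤)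
open import Data.Bool using (Bool; true; false; _∧_; not; if_then_else_)
open import Data.Bool.Properties using (∧-comm; ∧-conicalˡ; ∧-conicalʳ)
open import Data.Product using (_,_; proj₁; proj₂)
open import Data.Sum using (inj₁; inj₂)
open import Function using (_∘_)
open import Relation.Nullary using (¬_; Dec; yes; no; does; contradiction)
open import Relation.Nullary.Decidable using (dec-true; dec-false; decidable-stable; ¬¬-excluded-middle)
open import Relation.Nullary.Negation using (¬¬-map)
open import Relation.Binary.PropositionalEquality
  using (_≡_; _≢_; refl; sym; trans; cong; cong₂; module ≡-Reasoning)

¬¬-∀-Fin : ∀ {n} {P : Fin n → Set} → (∀ i → ¬ ¬ P i) → ¬ ¬ (∀ i → P i)
¬¬-∀-Fin {ℕ.zero} _ ¬∀ = ¬∀ λ ()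
¬¬-∀-Fin {suc n} {P} ¬¬P ¬∀ =
  ¬¬P zero λ p₀ → ¬¬-∀-Fin {P = P ∘ suc} (¬¬P ∘ suc) λ ps →
    ¬∀ λ { zero → p₀ ; (suc i) → ps i }

module Cyclic (k : ℕ) where

  infixl 6 _⊕_ _⊖_

  _⊕_ : Fin (suc k) → Fin (suc k) → Fin (suc k)
  a ⊕ b = fromℕ< (m%n<n (toℕ a + toℕ b) (suc k))

  _⊖_ : Fin (suc k) → Fin (suc k) → Fin (suc k)
  a ⊖ b = fromℕ< (m%n<n (toℕ a + (suc k ∸ toℕ b)) (suc k))

  toℕ-⊕ : ∀ a b → toℕ (a ⊕ b) ≡ (toℕ a + toℕ b) % suc k
  toℕ-⊕ a b = toℕ-fromℕ< (m%n<n (toℕ a + toℕ b) (suc k))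

  toℕ-⊖ : ∀ a b → toℕ (a ⊖ b) ≡ (toℕ a + (suc k ∸ toℕ b)) % suc k
  toℕ-⊖ a b = toℕ-fromℕ< (m%n<n (toℕ a + (suc k ∸ toℕ b)) (suc k))

  ⊕-comm : ∀ a b → a ⊕ b ≡ b ⊕ a
  ⊕-comm a b = toℕ-injective (trans (toℕ-⊕ a b)
    (trans (cong (_% suc k) (+-comm (toℕ a) (toℕ b))) (sym (toℕ-⊕ b a))))

  ⊕-⊖-cancel : ∀ a b → a ⊕ b ⊖ b ≡ a
  ⊕-⊖-cancel a b = toℕ-injective (begin
    toℕ (a ⊕ b ⊖ b)                             ≡⟨ toℕ-⊖ (a ⊕ b) b ⟩
    (toℕ (a ⊕ b) + (K ∸ toℕ b)) % K             ≡⟨ cong (λ z → (z + (K ∸ toℕ b)) % K) (toℕ-⊕ a b) ⟩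
    ((toℕ a + toℕ b) % K + (K ∸ toℕ b)) % K     ≡⟨ [m%n+o]%n≡[m+o]%n (toℕ a + toℕ b) (K ∸ toℕ b) ⟩
    (toℕ a + toℕ b + (K ∸ toℕ b)) % K           ≡⟨ cong (_% K) (+-assoc (toℕ a) (toℕ b) _) ⟩
    (toℕ a + (toℕ b + (K ∸ toℕ b))) % K         ≡⟨ cong (λ z → (toℕ a + z) % K) (m+[n∸m]≡n (<⇒≤ (toℕ<n b))) ⟩
    (toℕ a + K) % K                             ≡⟨ [m+n]%n≡m%n (toℕ a) K ⟩
    toℕ a % K                                   ≡⟨ m<n⇒m%n≡m (toℕ<n a) ⟩
    toℕ a                                       ∎)
    where
    open ≡-Reasoning
    K = suc k
    [m%n+o]%n≡[m+o]%n : ∀ m o → (m % K + o) % K ≡ (m + o) % K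
    [m%n+o]%n≡[m+o]%n m o = begin
      (m % K + o) % K             ≡⟨ %-distribˡ-+ (m % K) o K ⟩
      (m % K % K + o % K) % K     ≡⟨ cong (λ z → (z + o % K) % K) (m%n%n≡m%n m K) ⟩
      (m % K + o % K) % K         ≡⟨ sym (%-distribˡ-+ m o K) ⟩
      (m + o) % K                 ∎

  ⊕-cancelʳ : ∀ {a b} c → a ⊕ c ≡ b ⊕ c → a ≡ b
  ⊕-cancelʳ {a} {b} c eq =
    trans (sym (⊕-⊖-cancel a c)) (trans (cong (_⊖ c) eq) (⊕-⊖-cancel b c))

  ⊕-cancelˡ : ∀ a {b c} → a ⊕ b ≡ a ⊕ c → b ≡ c
  ⊕-cancelˡ a {b} {c} eq = ⊕-cancelʳ a (trans (⊕-comm b a) (trans eq (⊕-comm a c)))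

Reach-snoc : ∀ {n} {E : Fin n → Fin n → Bool} {x y z} → Reach E x y → E y z ≡ true → Reach E x z
Reach-snoc here       yz = step yz here
Reach-snoc (step e r) yz = step e (Reach-snoc r yz)

module _ (G : Graph) where

  adj⇒≢ : ∀ {x y} → adj G x y ≡ true → x ≢ y
  adj⇒≢ {x} xy refl = contradiction (trans (sym xy) (irrefl G x)) λ ()

  edgeless⇒colorable : ∀ {k} → (∀ x y → adj G x y ≢ true) → Colorable G (suc k)
  edgeless⇒colorable no-edge = (λ _ → zero) , λ x y xy → contradiction xy (no-edge x y)

  remove-≡-adj : (R : EdgeSet G) {x y : Fin (n G)} → mem R x y ≡ false → remove G R x y ≡ adj G x y
  remove-≡-adj R {x} {y} _ with mem R x y
  ... | false = refl

  induced : (Fin (n G) → Bool) → Subgraph G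
  induced p = record
    { vs     = p
    ; es     = λ x y → (p x ∧ p y) ∧ adj G x y
    ; es-sym = λ x y → cong₂ _∧_ (∧-comm (p x) (p y)) (Graph.sym G x y)
    ; es-adj = λ x y → ∧-conicalʳ _ _
    ; es-vs  = λ x y → ∧-conicalˡ _ _ ∘ ∧-conicalˡ _ _
    }

  induced-edge : ∀ {p x y} → p x ≡ true → p y ≡ true → adj G x y ≡ true →
    es (induced p) x y ≡ true
  induced-edge {p} {x} {y} px py xy = trans (cong₂ (λ a b → (a ∧ b) ∧ adj G x y) px py) xy

module Gluing {G : Graph} {k : ℕ} (side : Fin (n G) → Bool)
  (col₁ : SubColorable G (induced G side) (suc k))
  (col₂ : SubColorable G (induced G (not ∘ side)) (suc k)) where

  open Cyclic k

  f₁ f₂ : Fin (n G) → Fin (suc k)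
  f₁ = proj₁ col₁
  f₂ = proj₁ col₂

  glue : Fin (suc k) → Fin (n G) → Fin (suc k)
  glue s x = if side x then f₁ x else f₂ x ⊕ s

  record Conflict (s : Fin (suc k)) : Set where
    constructor conflict
    field
      inner outer : Fin (n G)
      inner-in    : side inner ≡ true
      outer-out   : side outer ≡ false
      edge        : adj G inner outer ≡ true
      clash       : f₁ inner ≡ f₂ outer ⊕ s
  open Conflict

  glue-colorable : ∀ s → ¬ Conflict s → Colorable G (suc k)
  glue-colorable s no-conflict = glue s , proper
    where
    proper : ∀ x y → adj G x y ≡ true → glue s x ≢ glue s y
    proper x y xy with side x in sx | side y in sy
    ... | true  | true  = proj₂ col₁ x y (induced-edge G sx sy xy)
    ... | false | false = proj₂ col₂ x y (induced-edge G (cong not sx) (cong not sy) xy) ∘ ⊕-cancelʳ s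
    ... | true  | false = no-conflict ∘ conflict x y sx sy xy
    ... | false | true  = no-conflict ∘ conflict y x sy sx (trans (Graph.sym G y x) xy) ∘ sym

  conflict-shift : ∀ {s t} (c : Conflict s) (d : Conflict t) →
    inner c ≡ inner d → outer c ≡ outer d → s ≡ t
  conflict-shift {s} {t} c d same-inner same-outer = ⊕-cancelˡ (f₂ (outer c)) (begin
    f₂ (outer c) ⊕ s   ≡⟨ sym (clash c) ⟩
    f₁ (inner c)       ≡⟨ cong f₁ same-inner ⟩
    f₁ (inner d)       ≡⟨ clash d ⟩
    f₂ (outer d) ⊕ t   ≡⟨ cong (λ z → f₂ z ⊕ t) (sym same-outer) ⟩
    f₂ (outer c) ⊕ t   ∎)
    where open ≡-Reasoning

  all-conflicts⇒≤ : ∀ {m} (c : EdgeColoring G m) (R : EdgeSet G) → Rainbow c R →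
    (∀ x y → side x ≡ true → side y ≡ false → adj G x y ≡ true → mem R x y ≡ true) →
    (∀ s → Conflict s) → suc k ≤ m
  all-conflicts⇒≤ {m} c R rainbow crossing⊆R conflicts = injective⇒≤ {f = colour} colour-injective
    where
    colour : Fin (suc k) → Fin m
    colour s = col c (inner (conflicts s)) (outer (conflicts s))

    in-R : ∀ s → mem R (inner (conflicts s)) (outer (conflicts s)) ≡ true
    in-R s = let d = conflicts s in crossing⊆R _ _ (inner-in d) (outer-out d) (edge d)

    colour-injective : ∀ {s t} → colour s ≡ colour t → s ≡ t
    colour-injective {s} {t} eq with rainbow _ _ _ _ (in-R s) (in-R t) eq
    ... | inj₁ (same-inner , same-outer) = conflict-shift (conflicts s) (conflicts t) same-inner same-outer
    ... | inj₂ (inner≡outer , _) = contradiction (begin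
      true                       ≡⟨ sym (inner-in (conflicts s)) ⟩
      side (inner (conflicts s)) ≡⟨ cong side inner≡outer ⟩
      side (outer (conflicts t)) ≡⟨ outer-out (conflicts t) ⟩
      false                      ∎) λ ()
      where open ≡-Reasoning

module ReachableSide (G : Graph) (R : EdgeSet G) (u : Fin (n G))
  (reach? : ∀ x → Dec (Reach (remove G R) u x)) where

  reached : Fin (n G) → Bool
  reached x = does (reach? x)

  crossing⊆R : ∀ x y → reached x ≡ true → reached y ≡ false → adj G x y ≡ true → mem R x y ≡ true
  crossing⊆R x y _ _ xy with reach? x | reach? y
  ... | yes u⇝x | no u↛y with mem R x y in xy∈R
  ...   | true  = refl
  ...   | false = contradiction (Reach-snoc u⇝x (trans (remove-≡-adj G R xy∈R) xy)) u↛y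

rainbow-cut-bound : ∀ {G k m} → ¬ Colorable G (suc k) →
  (∀ H → ProperSubgraph G H → SubColorable G H (suc k)) →
  (c : EdgeColoring G m) {u v : Fin (n G)} {R : EdgeSet G} → RainbowCut c u v R →
  (∀ x → Dec (Reach (remove G R) u x)) → ¬ ¬ (suc k ≤ m)
rainbow-cut-bound {G} uncolourable critical c {u} {v} {R} (rainbow , u↛v) reach? =
  ¬¬-map (all-conflicts⇒≤ c R rainbow crossing⊆R)
         (¬¬-∀-Fin λ s → uncolourable ∘ glue-colorable s)
  where
  open ReachableSide G R u reach?
  open Gluing reached
    (critical (induced G reached) (inj₁ (v , dec-false (reach? v) u↛v)))
    (critical (induced G (not ∘ reached)) (inj₁ (u , cong not (dec-true (reach? u) here))))

-- Decidability of reachability in G - R is only used under a double negation,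
-- which suffices because the conclusion k ≤ m is itself decidable.
rd-lower-bound : ∀ {G k m} → ¬ Colorable G (suc k) →
  (∀ H → ProperSubgraph G H → SubColorable G H (suc k)) →
  (c : EdgeColoring G m) → RainbowDisconnected c → ¬ ¬ (suc k ≤ m)
rd-lower-bound {G} uncolourable critical c rd k≰m = uncolourable (edgeless⇒colorable G no-edge)
  where
  no-edge : ∀ x y → adj G x y ≢ true
  no-edge x y xy with rd x y (adj⇒≢ G xy)
  ... | R , cut =
    ¬¬-∀-Fin {P = λ z → Dec (Reach (remove G R) x z)} (λ _ → ¬¬-excluded-middle) λ reach? →
      rainbow-cut-bound uncolourable critical c {x} {y} {R} cut reach? k≰m

theorem2 : (k : ℕ) → 1 ≤ k → (G : Graph) → Connected G → Critical G k → RdAtLeast G k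
theorem2 (suc k) _ G _ ((_ , χ-minimal) , critical) m c rd =
  decidable-stable (suc k ≤? m)
    (rd-lower-bound (λ col → 1+n≰n (χ-minimal (suc k) col)) critical c rd)
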